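{- For all integers $n\geq 0$ and $k\in\mathbb{Z}$, \[ E_{n}^{(k)}=\sum_{l=0}^{n}\sum_{m=0}^{l}\sum_{j=1}^{m+1}\binom{n}{l}\binom{l}{m}\frac{2^{m+n-l}(-1)^{m+1+j}\,j!}{(l-m+1)\,j^{k}\,(m+1)}\,S_{2}(m+1,j)\,B_{n-l}. \]
   Context: For $k\in\mathbb{Z}$, $\mathrm{Li}_k(z)=\sum_{n=1}^{\infty}\frac{z^n}{n^k}$. The poly-Euler polynomials $E_n^{(k)}(x)$ are defined by \[ \frac{\mathrm{Li}_{k}(1-e^{ -2t})}{t(e^{t}+1)}e^{xt}=\sum_{n=0}^{\infty}E_{n}^{(k)}(x)\frac{t^{n}}{n!}, \] and the poly-Euler numbers are $E_n^{(k)}=E_n^{(k)}(0)$. The Bernoulli numbers $B_n$ are defined by $\frac{t}{e^t-1}=\sum_{n\ge0}B_n\frac{t^n}{n!}$. The Stirling numbers of the second kind are defined by $\frac{1}{m!}(e^t-1)^m=\sum_{n=m}^{\infty}S_2(n,m)\frac{t^n}{n!}$. -}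

module Defs where

open import Data.Nat as ℕ using (ℕ; zero; suc; _∸_)
open import Data.Nat.Combinatorics using (_C_)
open import Data.Integer as ℤ using (ℤ; +_; -[1+_])
open import Data.Rational using (ℚ; 0ℚ; 1ℚ; _+_; _*_; -_; _-_; _/_; 1/_; NonZero)
open import Data.List using (List; []; _∷_; _++_; map; upTo; zipWith; foldr; last)
open import Data.Maybe using (fromMaybe)
import Data.Nat.Properties as ℕP

-- Formal power series over ℚ, represented by their coefficient sequences:
-- f = Σ_N f N · t^N.
Series : Set
Series = ℕ → ℚ

ℕ→ℚ : ℕ → ℚ
ℕ→ℚ n = + n / 1

sumℚ : List ℚ → ℚ
sumℚ = foldr _+_ 0ℚ

Σ0to : ℕ → (ℕ → ℚ) → ℚ
Σ0to n f = sumℚ (map f (upTo (suc n)))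

Σ1to : ℕ → (ℕ → ℚ) → ℚ
Σ1to n f = sumℚ (map (λ i → f (suc i)) (upTo n))

fact : ℕ → ℕ
fact zero    = 1
fact (suc n) = suc n ℕ.* fact n

factNZ : ∀ N → ℕ.NonZero (fact N)
factNZ zero    = _
factNZ (suc N) = ℕP.m*n≢0 (suc N) (fact N) ⦃ _ ⦄ ⦃ factNZ N ⦄

powℚ : ℚ → ℕ → ℚ
powℚ q zero    = 1ℚ
powℚ q (suc n) = q * powℚ q n

-- integer power n^k of a positive natural n (k ∈ ℤ); value at n = 0 is junk (0)
natZPow : ℕ → ℤ → ℚ
natZPow zero    _        = 0ℚ
natZPow (suc n) (+ k)    = powℚ (ℕ→ℚ (suc n)) k
natZPow (suc n) -[1+ k ] = _/_ (+ 1) (suc n ℕ.^ suc k) ⦃ ℕP.m^n≢0 (suc n) (suc k) ⦄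

expS : ℚ → Series
expS a N = powℚ a N * _/_ (+ 1) (fact N) ⦃ factNZ N ⦄

constS : ℚ → Series
constS c zero    = c
constS c (suc _) = 0ℚ

_⊕_ : Series → Series → Series
(f ⊕ g) N = f N + g N

_⊖_ : Series → Series → Series
(f ⊖ g) N = f N - g N

_⊛_ : Series → Series → Series
(f ⊛ g) N = Σ0to N (λ i → f i * g (N ∸ i))

powS : Series → ℕ → Series
powS f zero    = constS 1ℚ
powS f (suc m) = f ⊛ powS f m

-- division by t (valid when the constant term vanishes)
divT : Series → Series
divT f N = f (suc N)

-- multiplicative inverse of a series f with f 0 ≠ 0:
-- b_0 = 1/f_0 ,  b_N = -(1/f_0) Σ_{i=0}^{N-1} f_{N-i} b_i
invCoeffs : (f : Series) → ℚ → ℕ → List ℚ   -- [b_0 , … , b_N], given c = 1/f_0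
invCoeffs f c zero    = c ∷ []
invCoeffs f c (suc N) =
  bs ++ (- c * sumℚ (zipWith (λ i b → f (suc N ∸ i) * b) (upTo (suc N)) bs)) ∷ []
  where bs = invCoeffs f c N

invS : (f : Series) → .⦃ NonZero (f 0) ⦄ → Series
invS f N = fromMaybe 0ℚ (last (invCoeffs f (1/ f 0) N))

-- polylogarithm composed with a series g with g 0 = 0:
-- Li_k(g(t)) = Σ_{n≥1} g(t)^n / n^k ; only n ≤ N contribute to the t^N coefficient
LiS : ℤ → Series → Series
LiS k g N = Σ1to N (λ n → natZPow n (ℤ.- k) * powS g n N)

-- Stirling numbers of the second kind:  (e^t - 1)^m / m! = Σ_n S₂(n,m) t^n / n!
S₂ : ℕ → ℕ → ℚ
S₂ n m = ℕ→ℚ (fact n) * powS (expS 1ℚ ⊖ constS 1ℚ) m n * _/_ (+ 1) (fact m) ⦃ factNZ m ⦄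

-- Bernoulli numbers: t/(e^t - 1) = Σ B_n t^n / n!
-- (t/(e^t-1) is the inverse of the series (e^t - 1)/t, whose constant term is 1)
BernoulliSeries : Series
BernoulliSeries = invS (divT (expS 1ℚ ⊖ constS 1ℚ)) ⦃ _ ⦄

B : ℕ → ℚ
B n = ℕ→ℚ (fact n) * BernoulliSeries n

-- generating function of the poly-Euler polynomials at x = 0:
--   Li_k(1 - e^{-2t}) / (t (e^t + 1))
polyEulerSeries : ℤ → Series
polyEulerSeries k =
  divT (LiS k (constS 1ℚ ⊖ expS (- (ℕ→ℚ 2)))) ⊛ invS (expS 1ℚ ⊕ constS 1ℚ) ⦃ _ ⦄

polyEuler : ℕ → ℤ → ℚ
polyEuler n k = ℕ→ℚ (fact n) * polyEulerSeries k n

{-# OPTIONS --safe #-}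
module Submission where

open import Defs
open import Data.Nat as ℕ using (ℕ; zero; suc; _∸_; z≤n; s≤s; _<_; _≤_; _!)
import Data.Nat.Properties as ℕP
open import Data.Nat.DivMod using (m/n*n≡m)
open import Data.Nat.Combinatorics using (_C_; k![n∸k]!∣n!; nCk+nC[k+1]≡[n+1]C[k+1])
open import Data.Nat.Combinatorics.Specification using (nCk≡n!/k![n-k]!; k>n⇒nCk≡0)
open import Data.Integer as ℤ using (ℤ; +_)
import Data.Integer.Properties as ℤP
open import Data.Rational using (ℚ; 0ℚ; 1ℚ; ½; _+_; _*_; -_; _-_; _/_; 1/_; toℚᵘ; NonZero)
open import Data.Rational.Properties
import Data.Rational.Unnormalised as U
import Data.Rational.Unnormalised.Properties as UP
open import Data.Rational.Solver
open import Data.List using (List; []; _∷_; _++_; map; upTo; applyUpTo; zipWith; last)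
open import Data.List.Properties using (applyUpTo-∷ʳ; map-++)
open import Data.Maybe using (just; fromMaybe)
open import Function using (_∘_)
open import Relation.Binary.PropositionalEquality
open +-*-Solver

-- Since 1/(eᵗ + 1) = (eᵗ - 1)/(e²ᵗ - 1), the generating function factors as
--   Li_k(1 - e⁻²ᵗ)/t · (eᵗ - 1)/t · t/(e²ᵗ - 1),   with   t/(e²ᵗ - 1) = ½ Σ Bₙ (2t)ⁿ/n!.
-- Expanding (1 - e⁻²ᵗ)ʲ = (-1)ʲ (e^(-2t) - 1)ʲ through the Stirling numbers, (eᵗ - 1)/t as
-- Σ tᵃ/(a+1)!, and reading off the tⁿ coefficient of the triple Cauchy product gives the
-- triple sum; the multinomial coefficient n!/((m+1)! (l-m+1)! (n-l)!) produces the binomials.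

-- Arithmetic in ℚ

toℚᵘ-/ : ∀ i n .{{_ : ℕ.NonZero n}} → toℚᵘ (i / n) U.≃ U.mkℚᵘ i (ℕ.pred n)
toℚᵘ-/ i (suc d) = toℚᵘ-fromℚᵘ (U.mkℚᵘ i d)

ℕ→ℚ-+ : ∀ a b → ℕ→ℚ (a ℕ.+ b) ≡ ℕ→ℚ a + ℕ→ℚ b
ℕ→ℚ-+ a b = toℚᵘ-injective (begin
  toℚᵘ (ℕ→ℚ (a ℕ.+ b))            ≈⟨ toℚᵘ-/ (+ (a ℕ.+ b)) 1 ⟩
  U.mkℚᵘ (+ (a ℕ.+ b)) 0          ≡⟨ cong (λ z → U.mkℚᵘ z 0) (trans (ℤP.pos-+ a b)
                                       (sym (cong₂ ℤ._+_ (ℤP.*-identityʳ (+ a)) (ℤP.*-identityʳ (+ b))))) ⟩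
  U.mkℚᵘ (+ a) 0 U.+ U.mkℚᵘ (+ b) 0 ≈⟨ UP.+-cong (toℚᵘ-/ (+ a) 1) (toℚᵘ-/ (+ b) 1) ⟨
  toℚᵘ (ℕ→ℚ a) U.+ toℚᵘ (ℕ→ℚ b)   ≈⟨ toℚᵘ-homo-+ (ℕ→ℚ a) (ℕ→ℚ b) ⟨
  toℚᵘ (ℕ→ℚ a + ℕ→ℚ b)            ∎)
  where open UP.≃-Reasoning

ℕ→ℚ-* : ∀ a b → ℕ→ℚ (a ℕ.* b) ≡ ℕ→ℚ a * ℕ→ℚ b
ℕ→ℚ-* a b = toℚᵘ-injective (begin
  toℚᵘ (ℕ→ℚ (a ℕ.* b))            ≈⟨ toℚᵘ-/ (+ (a ℕ.* b)) 1 ⟩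
  U.mkℚᵘ (+ (a ℕ.* b)) 0          ≡⟨ cong (λ z → U.mkℚᵘ z 0) (ℤP.pos-* a b) ⟩
  U.mkℚᵘ (+ a) 0 U.* U.mkℚᵘ (+ b) 0 ≈⟨ UP.*-cong (toℚᵘ-/ (+ a) 1) (toℚᵘ-/ (+ b) 1) ⟨
  toℚᵘ (ℕ→ℚ a) U.* toℚᵘ (ℕ→ℚ b)   ≈⟨ toℚᵘ-homo-* (ℕ→ℚ a) (ℕ→ℚ b) ⟨
  toℚᵘ (ℕ→ℚ a * ℕ→ℚ b)            ∎)
  where open UP.≃-Reasoning

n*[1/n]≡1 : ∀ n .{{_ : ℕ.NonZero n}} → ℕ→ℚ n * (+ 1 / n) ≡ 1ℚ
n*[1/n]≡1 (suc n) = toℚᵘ-injective (begin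
  toℚᵘ (ℕ→ℚ (suc n) * (+ 1 / suc n))           ≈⟨ toℚᵘ-homo-* (ℕ→ℚ (suc n)) (+ 1 / suc n) ⟩
  toℚᵘ (ℕ→ℚ (suc n)) U.* toℚᵘ (+ 1 / suc n)    ≈⟨ UP.*-cong (toℚᵘ-/ (+ suc n) 1) (toℚᵘ-/ (+ 1) (suc n)) ⟩
  U.mkℚᵘ (+ suc n) 0 U.* U.mkℚᵘ (+ 1) n        ≈⟨ U.*≡* (cong (λ x → + suc x) (trans (ℕP.*-identityʳ _)
                                                   (trans (ℕP.*-identityʳ n) (sym (trans (ℕP.+-identityʳ _) (ℕP.+-identityʳ n)))))) ⟩
  toℚᵘ 1ℚ                                      ∎)
  where open UP.≃-Reasoning

1/[m*n]≡1/m*1/n : ∀ a b .{{_ : ℕ.NonZero a}} .{{_ : ℕ.NonZero b}} →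
                  _/_ (+ 1) (a ℕ.* b) {{ℕP.m*n≢0 a b}} ≡ (+ 1 / a) * (+ 1 / b)
1/[m*n]≡1/m*1/n a b = begin
  u                                ≡⟨ solve 1 (λ u → u := u :* con 1ℚ :* con 1ℚ) refl u ⟩
  u * 1ℚ * 1ℚ                      ≡⟨ cong₂ (λ p q → u * p * q) (sym (n*[1/n]≡1 a)) (sym (n*[1/n]≡1 b)) ⟩
  u * (ℕ→ℚ a * x) * (ℕ→ℚ b * y)    ≡⟨ solve 5 (λ u a x b y → u :* (a :* x) :* (b :* y) := (a :* b) :* u :* x :* y)
                                        refl u (ℕ→ℚ a) x (ℕ→ℚ b) y ⟩
  (ℕ→ℚ a * ℕ→ℚ b) * u * x * y      ≡⟨ cong (λ z → z * u * x * y) (sym (ℕ→ℚ-* a b)) ⟩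
  ℕ→ℚ (a ℕ.* b) * u * x * y        ≡⟨ cong (λ z → z * x * y) (n*[1/n]≡1 (a ℕ.* b) {{ℕP.m*n≢0 a b}}) ⟩
  1ℚ * x * y                       ≡⟨ solve 2 (λ x y → con 1ℚ :* x :* y := x :* y) refl x y ⟩
  x * y                            ∎
  where
  open ≡-Reasoning
  u = _/_ (+ 1) (a ℕ.* b) {{ℕP.m*n≢0 a b}}
  x = + 1 / a
  y = + 1 / b

2ℚ : ℚ
2ℚ = ℕ→ℚ 2

powℚ-1ℚ : ∀ n → powℚ 1ℚ n ≡ 1ℚ
powℚ-1ℚ zero    = refl
powℚ-1ℚ (suc n) = trans (*-identityˡ _) (powℚ-1ℚ n)

powℚ-+ : ∀ q a b → powℚ q (a ℕ.+ b) ≡ powℚ q a * powℚ q b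
powℚ-+ q zero    b = sym (*-identityˡ _)
powℚ-+ q (suc a) b = trans (cong (q *_) (powℚ-+ q a b)) (sym (*-assoc q _ _))

powℚ-* : ∀ p q n → powℚ (p * q) n ≡ powℚ p n * powℚ q n
powℚ-* p q zero    = refl
powℚ-* p q (suc n) = trans (cong (p * q *_) (powℚ-* p q n))
  (solve 4 (λ p q a b → p :* q :* (a :* b) := p :* a :* (q :* b)) refl p q _ _)

ℕ→ℚ-^ : ∀ a n → ℕ→ℚ (a ℕ.^ n) ≡ powℚ (ℕ→ℚ a) n
ℕ→ℚ-^ a zero    = refl
ℕ→ℚ-^ a (suc n) = trans (ℕ→ℚ-* a (a ℕ.^ n)) (cong (ℕ→ℚ a *_) (ℕ→ℚ-^ a n))

invFact : ℕ → ℚ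
invFact n = _/_ (+ 1) (fact n) {{factNZ n}}

n!*[1/n!]≡1 : ∀ n → ℕ→ℚ (fact n) * invFact n ≡ 1ℚ
n!*[1/n!]≡1 n = n*[1/n]≡1 (fact n) {{factNZ n}}

fact≡! : ∀ n → fact n ≡ n !
fact≡! zero    = refl
fact≡! (suc n) = cong (suc n ℕ.*_) (fact≡! n)

nCk*k!*[n∸k]!≡n! : ∀ {n k} → k ≤ n → ℕ→ℚ (n C k) * (ℕ→ℚ (fact k) * ℕ→ℚ (fact (n ∸ k))) ≡ ℕ→ℚ (fact n)
nCk*k!*[n∸k]!≡n! {n} {k} k≤n = begin
  ℕ→ℚ (n C k) * (ℕ→ℚ (fact k) * ℕ→ℚ (fact (n ∸ k))) ≡⟨ cong (ℕ→ℚ (n C k) *_) (sym (ℕ→ℚ-* (fact k) (fact (n ∸ k)))) ⟩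
  ℕ→ℚ (n C k) * ℕ→ℚ (fact k ℕ.* fact (n ∸ k))       ≡⟨ sym (ℕ→ℚ-* (n C k) _) ⟩
  ℕ→ℚ ((n C k) ℕ.* (fact k ℕ.* fact (n ∸ k)))       ≡⟨ cong ℕ→ℚ inℕ ⟩
  ℕ→ℚ (fact n)                                      ∎
  where
  open ≡-Reasoning
  inℕ : (n C k) ℕ.* (fact k ℕ.* fact (n ∸ k)) ≡ fact n
  inℕ rewrite fact≡! k | fact≡! (n ∸ k) | fact≡! n =
    trans (cong (ℕ._* (k ! ℕ.* (n ∸ k) !)) (nCk≡n!/k![n-k]! k≤n))
          (m/n*n≡m {{ℕP._!*_!≢0 k (n ∸ k)}} (k![n∸k]!∣n! k≤n))

multinomial : ∀ {n l m} → l ≤ n → m ≤ l →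
  ℕ→ℚ (fact n) * invFact (suc m) * invFact (suc (l ∸ m)) * invFact (n ∸ l)
    ≡ ℕ→ℚ (n C l) * ℕ→ℚ (l C m) * (+ 1 / (suc (l ∸ m) ℕ.* suc m))
multinomial {n} {l} {m} l≤n m≤l = begin
  ℕ→ℚ (fact n) * invFact (suc m) * invFact (suc a) * invFact b
    ≡⟨ cong₂ (λ x y → x * y * invFact (suc a) * invFact b) (sym n!-split) (1/[m*n]≡1/m*1/n (suc m) (fact m) {{_}} {{factNZ m}}) ⟩
  Cnl * (Clm * (Fm * Fa) * Fb) * (sm⁻¹ * invFact m) * invFact (suc a) * invFact b
    ≡⟨ cong (λ x → Cnl * (Clm * (Fm * Fa) * Fb) * (sm⁻¹ * invFact m) * x * invFact b)
            (1/[m*n]≡1/m*1/n (suc a) (fact a) {{_}} {{factNZ a}}) ⟩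
  Cnl * (Clm * (Fm * Fa) * Fb) * (sm⁻¹ * invFact m) * (sa⁻¹ * invFact a) * invFact b
    ≡⟨ solve 10 (λ cnl clm fm fa fb sm im sa ia ib →
         cnl :* (clm :* (fm :* fa) :* fb) :* (sm :* im) :* (sa :* ia) :* ib
           := cnl :* clm :* (sa :* sm) :* (fm :* im) :* (fa :* ia) :* (fb :* ib))
         refl Cnl Clm Fm Fa Fb sm⁻¹ (invFact m) sa⁻¹ (invFact a) (invFact b) ⟩
  Cnl * Clm * (sa⁻¹ * sm⁻¹) * (Fm * invFact m) * (Fa * invFact a) * (Fb * invFact b)
    ≡⟨ cong₂ (λ x y → Cnl * Clm * (sa⁻¹ * sm⁻¹) * x * y * (Fb * invFact b)) (n!*[1/n!]≡1 m) (n!*[1/n!]≡1 a) ⟩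
  Cnl * Clm * (sa⁻¹ * sm⁻¹) * 1ℚ * 1ℚ * (Fb * invFact b)
    ≡⟨ cong₂ (λ x y → Cnl * Clm * x * 1ℚ * 1ℚ * y) (sym (1/[m*n]≡1/m*1/n (suc a) (suc m))) (n!*[1/n!]≡1 b) ⟩
  Cnl * Clm * (+ 1 / (suc a ℕ.* suc m)) * 1ℚ * 1ℚ * 1ℚ
    ≡⟨ solve 1 (λ x → x :* con 1ℚ :* con 1ℚ :* con 1ℚ := x) refl (Cnl * Clm * (+ 1 / (suc a ℕ.* suc m))) ⟩
  Cnl * Clm * (+ 1 / (suc a ℕ.* suc m)) ∎
  where
  open ≡-Reasoning
  a = l ∸ m
  b = n ∸ l
  Cnl = ℕ→ℚ (n C l)
  Clm = ℕ→ℚ (l C m)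
  Fm = ℕ→ℚ (fact m)
  Fa = ℕ→ℚ (fact a)
  Fb = ℕ→ℚ (fact b)
  sm⁻¹ = + 1 / suc m
  sa⁻¹ = + 1 / suc a
  n!-split : Cnl * (Clm * (Fm * Fa) * Fb) ≡ ℕ→ℚ (fact n)
  n!-split = trans (cong (λ z → Cnl * (z * Fb)) (nCk*k!*[n∸k]!≡n! m≤l)) (nCk*k!*[n∸k]!≡n! l≤n)

-- Finite sums

-- Opaque, so that the summand f of Σ< n f can be inferred by unification.
opaque
  Σ< : ℕ → (ℕ → ℚ) → ℚ
  Σ< zero    f = 0ℚ
  Σ< (suc n) f = f 0 + Σ< n (f ∘ suc)

opaque
  unfolding Σ<

  Σ<-suc : ∀ n f → Σ< (suc n) f ≡ f 0 + Σ< n (f ∘ suc)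
  Σ<-suc n f = refl

  Σ<-one : ∀ f → Σ< 1 f ≡ f 0
  Σ<-one f = +-identityʳ (f 0)

  sumℚ-map-applyUpTo : ∀ n (g : ℕ → ℕ) (f : ℕ → ℚ) → sumℚ (map f (applyUpTo g n)) ≡ Σ< n (f ∘ g)
  sumℚ-map-applyUpTo zero    g f = refl
  sumℚ-map-applyUpTo (suc n) g f = cong (_+_ (f (g 0))) (sumℚ-map-applyUpTo n (g ∘ suc) f)

  Σ<-cong-< : ∀ n {f g : ℕ → ℚ} → (∀ i → i < n → f i ≡ g i) → Σ< n f ≡ Σ< n g
  Σ<-cong-< zero    eq = refl
  Σ<-cong-< (suc n) eq = cong₂ _+_ (eq 0 (s≤s z≤n)) (Σ<-cong-< n (λ i i<n → eq (suc i) (s≤s i<n)))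

  Σ<-zero : ∀ n → Σ< n (λ _ → 0ℚ) ≡ 0ℚ
  Σ<-zero zero    = refl
  Σ<-zero (suc n) = trans (+-identityˡ _) (Σ<-zero n)

  Σ<-+ : ∀ n f g → Σ< n (λ i → f i + g i) ≡ Σ< n f + Σ< n g
  Σ<-+ zero    f g = refl
  Σ<-+ (suc n) f g = trans (cong (_+_ (f 0 + g 0)) (Σ<-+ n (f ∘ suc) (g ∘ suc)))
    (solve 4 (λ a b c d → (a :+ b) :+ (c :+ d) := (a :+ c) :+ (b :+ d)) refl (f 0) (g 0) _ _)

  Σ<-neg : ∀ n f → Σ< n (λ i → - f i) ≡ - Σ< n f
  Σ<-neg zero    f = refl
  Σ<-neg (suc n) f = trans (cong (_+_ (- f 0)) (Σ<-neg n (f ∘ suc))) (sym (neg-distrib-+ (f 0) _))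

  *-distribˡ-Σ< : ∀ n c f → c * Σ< n f ≡ Σ< n (λ i → c * f i)
  *-distribˡ-Σ< zero    c f = *-zeroʳ c
  *-distribˡ-Σ< (suc n) c f = trans (*-distribˡ-+ c (f 0) _) (cong (_+_ (c * f 0)) (*-distribˡ-Σ< n c (f ∘ suc)))

  Σ<-last : ∀ n f → Σ< (suc n) f ≡ Σ< n f + f n
  Σ<-last zero    f = trans (+-identityʳ (f 0)) (sym (+-identityˡ (f 0)))
  Σ<-last (suc n) f = trans (cong (_+_ (f 0)) (Σ<-last n (f ∘ suc))) (sym (+-assoc (f 0) _ _))

Σ<-cong : ∀ n {f g : ℕ → ℚ} → (∀ i → f i ≡ g i) → Σ< n f ≡ Σ< n g
Σ<-cong n eq = Σ<-cong-< n (λ i _ → eq i)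

*-distribʳ-Σ< : ∀ n c f → Σ< n f * c ≡ Σ< n (λ i → f i * c)
*-distribʳ-Σ< n c f = trans (*-comm _ c) (trans (*-distribˡ-Σ< n c f) (Σ<-cong n (λ i → *-comm c (f i))))

Σ0to≡Σ< : ∀ n f → Σ0to n f ≡ Σ< (suc n) f
Σ0to≡Σ< n f = sumℚ-map-applyUpTo (suc n) (λ i → i) f

Σ1to≡Σ< : ∀ n f → Σ1to n f ≡ Σ< n (f ∘ suc)
Σ1to≡Σ< n f = sumℚ-map-applyUpTo n (λ i → i) (f ∘ suc)

-- Formal power series

infix 4 _≈ₛ_
_≈ₛ_ : Series → Series → Set
f ≈ₛ g = ∀ N → f N ≡ g N

oneS : Series
oneS = constS 1ℚ

scaleS : ℚ → Series → Series
scaleS c f N = c * f N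

dilateS : ℚ → Series → Series
dilateS a f N = powℚ a N * f N

⊛-coeff : ∀ f g N → (f ⊛ g) N ≡ Σ< (suc N) (λ i → f i * g (N ∸ i))
⊛-coeff f g N = Σ0to≡Σ< N (λ i → f i * g (N ∸ i))

⊛-coeff-0 : ∀ f g → (f ⊛ g) 0 ≡ f 0 * g 0
⊛-coeff-0 f g = trans (⊛-coeff f g 0) (Σ<-one _)

⊛-coeff-sucˡ : ∀ f g N → (f ⊛ g) (suc N) ≡ f 0 * g (suc N) + (divT f ⊛ g) N
⊛-coeff-sucˡ f g N = trans (⊛-coeff f g (suc N)) (trans (Σ<-suc (suc N) _) (cong (_+_ (f 0 * g (suc N))) (sym (⊛-coeff (divT f) g N))))

⊛-coeff-sucʳ : ∀ f g N → (f ⊛ g) (suc N) ≡ (f ⊛ divT g) N + f (suc N) * g 0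
⊛-coeff-sucʳ f g N = begin
  (f ⊛ g) (suc N)                                                     ≡⟨ ⊛-coeff f g (suc N) ⟩
  Σ< (suc (suc N)) (λ i → f i * g (suc N ∸ i))                        ≡⟨ Σ<-last (suc N) _ ⟩
  Σ< (suc N) (λ i → f i * g (suc N ∸ i)) + f (suc N) * g (suc N ∸ suc N)
    ≡⟨ cong₂ _+_ (Σ<-cong-< (suc N) (λ i i≤N → cong (λ x → f i * g x) (ℕP.+-∸-assoc 1 (ℕP.≤-pred i≤N))))
                 (cong (λ x → f (suc N) * g x) (ℕP.n∸n≡0 N)) ⟩
  Σ< (suc N) (λ i → f i * divT g (N ∸ i)) + f (suc N) * g 0           ≡⟨ cong (_+ f (suc N) * g 0) (sym (⊛-coeff f (divT g) N)) ⟩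
  (f ⊛ divT g) N + f (suc N) * g 0                                    ∎
  where open ≡-Reasoning

⊛-cong : ∀ {f f′ g g′} → f ≈ₛ f′ → g ≈ₛ g′ → f ⊛ g ≈ₛ f′ ⊛ g′
⊛-cong {f} {f′} {g} {g′} f≈f′ g≈g′ N = trans (⊛-coeff f g N)
  (trans (Σ<-cong (suc N) (λ i → cong₂ _*_ (f≈f′ i) (g≈g′ (N ∸ i)))) (sym (⊛-coeff f′ g′ N)))

⊛-congˡ : ∀ f {g g′} → g ≈ₛ g′ → f ⊛ g ≈ₛ f ⊛ g′
⊛-congˡ f {g} {g′} = ⊛-cong {f} {f} {g} {g′} (λ _ → refl)

⊛-congʳ : ∀ g {f f′} → f ≈ₛ f′ → f ⊛ g ≈ₛ f′ ⊛ g
⊛-congʳ g f≈f′ = ⊛-cong f≈f′ (λ _ → refl)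

⊛-distribʳ-⊕ : ∀ f g h → (f ⊕ g) ⊛ h ≈ₛ (f ⊛ h) ⊕ (g ⊛ h)
⊛-distribʳ-⊕ f g h N = trans (⊛-coeff (f ⊕ g) h N)
  (trans (Σ<-cong (suc N) (λ i → *-distribʳ-+ (h (N ∸ i)) (f i) (g i)))
  (trans (Σ<-+ (suc N) _ _) (sym (cong₂ _+_ (⊛-coeff f h N) (⊛-coeff g h N)))))

⊛-distribʳ-⊖ : ∀ f g h → (f ⊖ g) ⊛ h ≈ₛ (f ⊛ h) ⊖ (g ⊛ h)
⊛-distribʳ-⊖ f g h N = trans (⊛-coeff (f ⊖ g) h N)
  (trans (Σ<-cong (suc N) (λ i → solve 3 (λ a b c → (a :- b) :* c := a :* c :+ :- (b :* c)) refl (f i) (g i) (h (N ∸ i))))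
  (trans (Σ<-+ (suc N) _ _) (trans (cong (_+_ (Σ< (suc N) (λ i → f i * h (N ∸ i)))) (Σ<-neg (suc N) _))
    (sym (cong₂ _-_ (⊛-coeff f h N) (⊛-coeff g h N))))))

⊛-scaleˡ : ∀ c f g → scaleS c f ⊛ g ≈ₛ scaleS c (f ⊛ g)
⊛-scaleˡ c f g N = trans (⊛-coeff (scaleS c f) g N)
  (trans (Σ<-cong (suc N) (λ i → *-assoc c (f i) (g (N ∸ i))))
  (trans (sym (*-distribˡ-Σ< (suc N) c _)) (cong (c *_) (sym (⊛-coeff f g N)))))

⊛-scaleʳ : ∀ c f g → f ⊛ scaleS c g ≈ₛ scaleS c (f ⊛ g)
⊛-scaleʳ c f g N = trans (⊛-coeff f (scaleS c g) N)
  (trans (Σ<-cong (suc N) (λ i → solve 3 (λ c a b → a :* (c :* b) := c :* (a :* b)) refl c (f i) (g (N ∸ i))))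
  (trans (sym (*-distribˡ-Σ< (suc N) c _)) (cong (c *_) (sym (⊛-coeff f g N)))))

scaleS-⊛-scaleS : ∀ c d f g → scaleS c f ⊛ scaleS d g ≈ₛ scaleS (c * d) (f ⊛ g)
scaleS-⊛-scaleS c d f g N = trans (⊛-scaleˡ c f (scaleS d g) N)
  (trans (cong (c *_) (⊛-scaleʳ d f g N)) (sym (*-assoc c d _)))

⊛-constˡ : ∀ c g → constS c ⊛ g ≈ₛ scaleS c g
⊛-constˡ c g zero    = ⊛-coeff-0 (constS c) g
⊛-constˡ c g (suc N) = begin
  (constS c ⊛ g) (suc N)                                  ≡⟨ ⊛-coeff-sucˡ (constS c) g N ⟩
  c * g (suc N) + (divT (constS c) ⊛ g) N                 ≡⟨ cong (_+_ (c * g (suc N))) (⊛-coeff (λ _ → 0ℚ) g N) ⟩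
  c * g (suc N) + Σ< (suc N) (λ i → 0ℚ * g (N ∸ i))       ≡⟨ cong (_+_ (c * g (suc N))) (Σ<-cong (suc N) (λ i → *-zeroˡ (g (N ∸ i)))) ⟩
  c * g (suc N) + Σ< (suc N) (λ _ → 0ℚ)                   ≡⟨ cong (_+_ (c * g (suc N))) (Σ<-zero (suc N)) ⟩
  c * g (suc N) + 0ℚ                                      ≡⟨ +-identityʳ _ ⟩
  c * g (suc N)                                           ∎
  where open ≡-Reasoning

⊛-comm : ∀ f g → f ⊛ g ≈ₛ g ⊛ f
⊛-comm f g zero    = trans (⊛-coeff-0 f g) (trans (*-comm (f 0) (g 0)) (sym (⊛-coeff-0 g f)))
⊛-comm f g (suc N) = begin
  (f ⊛ g) (suc N)                         ≡⟨ ⊛-coeff-sucˡ f g N ⟩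
  f 0 * g (suc N) + (divT f ⊛ g) N        ≡⟨ cong (_+_ (f 0 * g (suc N))) (⊛-comm (divT f) g N) ⟩
  f 0 * g (suc N) + (g ⊛ divT f) N        ≡⟨ solve 3 (λ a b x → a :* b :+ x := x :+ b :* a) refl (f 0) (g (suc N)) _ ⟩
  (g ⊛ divT f) N + g (suc N) * f 0        ≡⟨ sym (⊛-coeff-sucʳ g f N) ⟩
  (g ⊛ f) (suc N)                         ∎
  where open ≡-Reasoning

⊛-constʳ : ∀ c g → g ⊛ constS c ≈ₛ scaleS c g
⊛-constʳ c g N = trans (⊛-comm g (constS c) N) (⊛-constˡ c g N)

⊛-identityˡ : ∀ g → oneS ⊛ g ≈ₛ g
⊛-identityˡ g N = trans (⊛-constˡ 1ℚ g N) (*-identityˡ (g N))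

⊛-identityʳ : ∀ g → g ⊛ oneS ≈ₛ g
⊛-identityʳ g N = trans (⊛-constʳ 1ℚ g N) (*-identityˡ (g N))

⊛-assoc : ∀ f g h → (f ⊛ g) ⊛ h ≈ₛ f ⊛ (g ⊛ h)
⊛-assoc f g h zero = begin
  ((f ⊛ g) ⊛ h) 0      ≡⟨ trans (⊛-coeff-0 (f ⊛ g) h) (cong (_* h 0) (⊛-coeff-0 f g)) ⟩
  f 0 * g 0 * h 0      ≡⟨ *-assoc (f 0) (g 0) (h 0) ⟩
  f 0 * (g 0 * h 0)    ≡⟨ sym (trans (⊛-coeff-0 f (g ⊛ h)) (cong (f 0 *_) (⊛-coeff-0 g h))) ⟩
  (f ⊛ (g ⊛ h)) 0      ∎
  where open ≡-Reasoning
⊛-assoc f g h (suc N) = begin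
  ((f ⊛ g) ⊛ h) (suc N)
    ≡⟨ ⊛-coeff-sucˡ (f ⊛ g) h N ⟩
  (f ⊛ g) 0 * h (suc N) + (divT (f ⊛ g) ⊛ h) N
    ≡⟨ cong₂ _+_ (cong (_* h (suc N)) (⊛-coeff-0 f g)) (⊛-congʳ h (⊛-coeff-sucˡ f g) N) ⟩
  f 0 * g 0 * h (suc N) + ((scaleS (f 0) (divT g) ⊕ (divT f ⊛ g)) ⊛ h) N
    ≡⟨ cong (_+_ (f 0 * g 0 * h (suc N))) (trans (⊛-distribʳ-⊕ (scaleS (f 0) (divT g)) (divT f ⊛ g) h N)
         (cong₂ _+_ (⊛-scaleˡ (f 0) (divT g) h N) (⊛-assoc (divT f) g h N))) ⟩
  f 0 * g 0 * h (suc N) + (f 0 * (divT g ⊛ h) N + (divT f ⊛ (g ⊛ h)) N)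
    ≡⟨ solve 5 (λ a b c y x → a :* b :* c :+ (a :* y :+ x) := a :* (b :* c :+ y) :+ x) refl (f 0) (g 0) (h (suc N)) _ _ ⟩
  f 0 * (g 0 * h (suc N) + (divT g ⊛ h) N) + (divT f ⊛ (g ⊛ h)) N
    ≡⟨ cong (λ x → f 0 * x + (divT f ⊛ (g ⊛ h)) N) (sym (⊛-coeff-sucˡ g h N)) ⟩
  f 0 * (g ⊛ h) (suc N) + (divT f ⊛ (g ⊛ h)) N
    ≡⟨ sym (⊛-coeff-sucˡ f (g ⊛ h) N) ⟩
  (f ⊛ (g ⊛ h)) (suc N) ∎
  where open ≡-Reasoning

⊛-⊛-coeff : ∀ f g h n →
  ((f ⊛ g) ⊛ h) n ≡ Σ< (suc n) (λ l → Σ< (suc l) (λ m → f m * g (l ∸ m) * h (n ∸ l)))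
⊛-⊛-coeff f g h n = trans (⊛-coeff (f ⊛ g) h n) (Σ<-cong (suc n) (λ l →
  trans (cong (_* h (n ∸ l)) (⊛-coeff f g l)) (*-distribʳ-Σ< (suc l) (h (n ∸ l)) _)))

*-[⊛-⊛]-coeff : ∀ c (d : ℕ → ℕ → ℚ) f g h n → (∀ m → f m ≡ Σ< (suc m) (d m)) →
  c * ((f ⊛ g) ⊛ h) n
    ≡ Σ< (suc n) (λ l → Σ< (suc l) (λ m → Σ< (suc m) (λ i → c * (d m i * g (l ∸ m) * h (n ∸ l)))))
*-[⊛-⊛]-coeff c d f g h n f≡Σd = begin
  c * ((f ⊛ g) ⊛ h) n
    ≡⟨ cong (c *_) (⊛-⊛-coeff f g h n) ⟩
  c * Σ< (suc n) (λ l → Σ< (suc l) (λ m → f m * g (l ∸ m) * h (n ∸ l)))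
    ≡⟨ *-distribˡ-Σ< (suc n) c _ ⟩
  Σ< (suc n) (λ l → c * Σ< (suc l) (λ m → f m * g (l ∸ m) * h (n ∸ l)))
    ≡⟨ Σ<-cong (suc n) (λ l → trans (*-distribˡ-Σ< (suc l) c _) (Σ<-cong (suc l) (expand l))) ⟩
  Σ< (suc n) (λ l → Σ< (suc l) (λ m → Σ< (suc m) (λ i → c * (d m i * g (l ∸ m) * h (n ∸ l))))) ∎
  where
  open ≡-Reasoning
  expand : ∀ l m → c * (f m * g (l ∸ m) * h (n ∸ l)) ≡ Σ< (suc m) (λ i → c * (d m i * g (l ∸ m) * h (n ∸ l)))
  expand l m = begin
    c * (f m * x * y)                          ≡⟨ cong (λ z → c * (z * x * y)) (f≡Σd m) ⟩
    c * (Σ< (suc m) (d m) * x * y)             ≡⟨ cong (λ z → c * (z * y)) (*-distribʳ-Σ< (suc m) x (d m)) ⟩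
    c * (Σ< (suc m) (λ i → d m i * x) * y)     ≡⟨ cong (c *_) (*-distribʳ-Σ< (suc m) y _) ⟩
    c * Σ< (suc m) (λ i → d m i * x * y)       ≡⟨ *-distribˡ-Σ< (suc m) c _ ⟩
    Σ< (suc m) (λ i → c * (d m i * x * y))     ∎
    where
    x = g (l ∸ m)
    y = h (n ∸ l)

divT-⊛ : ∀ f g → f 0 ≡ 0ℚ → divT f ⊛ g ≈ₛ divT (f ⊛ g)
divT-⊛ f g f0≡0 N = sym (begin
  (f ⊛ g) (suc N)                     ≡⟨ ⊛-coeff-sucˡ f g N ⟩
  f 0 * g (suc N) + (divT f ⊛ g) N    ≡⟨ cong (λ x → x * g (suc N) + (divT f ⊛ g) N) f0≡0 ⟩
  0ℚ * g (suc N) + (divT f ⊛ g) N     ≡⟨ solve 2 (λ a x → con 0ℚ :* a :+ x := x) refl (g (suc N)) _ ⟩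
  (divT f ⊛ g) N                      ∎)
  where open ≡-Reasoning

last-∷ʳ : ∀ {A : Set} (xs : List A) y → last (xs ++ y ∷ []) ≡ just y
last-∷ʳ []            y = refl
last-∷ʳ (x ∷ [])      y = refl
last-∷ʳ (x ∷ x′ ∷ xs) y = last-∷ʳ (x′ ∷ xs) y

zipWith-map-self : ∀ {A B C : Set} (h : A → B → C) (b : A → B) xs →
                   zipWith h xs (map b xs) ≡ map (λ i → h i (b i)) xs
zipWith-map-self h b []       = refl
zipWith-map-self h b (x ∷ xs) = cong (h x (b x) ∷_) (zipWith-map-self h b xs)

module InvCoeffs (f : Series) (c : ℚ) where

  b : Series
  b N = fromMaybe 0ℚ (last (invCoeffs f c N))

  invCoeffs≡map : ∀ N → invCoeffs f c N ≡ map b (upTo (suc N))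
  invCoeffs≡map zero    = refl
  invCoeffs≡map (suc N) = trans
    (cong₂ (λ u v → u ++ v ∷ []) (invCoeffs≡map N) (sym (cong (fromMaybe 0ℚ) (last-∷ʳ (invCoeffs f c N) _))))
    (trans (sym (map-++ b (upTo (suc N)) (suc N ∷ []))) (cong (map b) (applyUpTo-∷ʳ (λ i → i) (suc N))))

  b-suc : ∀ N → b (suc N) ≡ - c * Σ< (suc N) (λ i → b i * f (suc N ∸ i))
  b-suc N = begin
    b (suc N)
      ≡⟨ cong (fromMaybe 0ℚ) (last-∷ʳ (invCoeffs f c N) _) ⟩
    - c * sumℚ (zipWith (λ i b → f (suc N ∸ i) * b) (upTo (suc N)) (invCoeffs f c N))
      ≡⟨ cong (λ xs → - c * sumℚ (zipWith (λ i b → f (suc N ∸ i) * b) (upTo (suc N)) xs)) (invCoeffs≡map N) ⟩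
    - c * sumℚ (zipWith (λ i b → f (suc N ∸ i) * b) (upTo (suc N)) (map b (upTo (suc N))))
      ≡⟨ cong (λ xs → - c * sumℚ xs) (zipWith-map-self (λ i b → f (suc N ∸ i) * b) b (upTo (suc N))) ⟩
    - c * Σ0to N (λ i → f (suc N ∸ i) * b i)
      ≡⟨ cong (- c *_) (trans (Σ0to≡Σ< N _) (Σ<-cong (suc N) (λ i → *-comm (f (suc N ∸ i)) (b i)))) ⟩
    - c * Σ< (suc N) (λ i → b i * f (suc N ∸ i)) ∎
    where open ≡-Reasoning

invS-inverseˡ : ∀ f .{{_ : NonZero (f 0)}} → invS f ⊛ f ≈ₛ oneS
invS-inverseˡ f zero    = trans (⊛-coeff-0 (invS f) f) (*-inverseˡ (f 0))
invS-inverseˡ f (suc N) = begin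
  (invS f ⊛ f) (suc N)              ≡⟨ trans (⊛-coeff (invS f) f (suc N)) (Σ<-last (suc N) _) ⟩
  T + b (suc N) * f (N ∸ N)         ≡⟨ cong₂ (λ x y → T + x * f y) (b-suc N) (ℕP.n∸n≡0 N) ⟩
  T + (- c * T) * f 0               ≡⟨ solve 3 (λ t c f → t :+ (:- c :* t) :* f := t :- t :* (c :* f)) refl T c (f 0) ⟩
  T - T * (c * f 0)                 ≡⟨ cong (λ x → T - T * x) (*-inverseˡ (f 0)) ⟩
  T - T * 1ℚ                        ≡⟨ solve 1 (λ t → t :- t :* con 1ℚ := con 0ℚ) refl T ⟩
  0ℚ                                ∎
  where
  open ≡-Reasoning
  c = 1/ f 0
  open InvCoeffs f c
  T = Σ< (suc N) (λ i → b i * f (suc N ∸ i))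

invS-unique : ∀ f g .{{_ : NonZero (f 0)}} → f ⊛ g ≈ₛ oneS → invS f ≈ₛ g
invS-unique f g f⊛g≈1 N = begin
  invS f N                ≡⟨ sym (⊛-identityʳ (invS f) N) ⟩
  (invS f ⊛ oneS) N       ≡⟨ ⊛-congˡ (invS f) (λ M → sym (f⊛g≈1 M)) N ⟩
  (invS f ⊛ (f ⊛ g)) N    ≡⟨ sym (⊛-assoc (invS f) f g N) ⟩
  ((invS f ⊛ f) ⊛ g) N    ≡⟨ ⊛-congʳ g (invS-inverseˡ f) N ⟩
  (oneS ⊛ g) N            ≡⟨ ⊛-identityˡ g N ⟩
  g N                     ∎
  where open ≡-Reasoning

dilateS-⊛ : ∀ a f g → dilateS a (f ⊛ g) ≈ₛ dilateS a f ⊛ dilateS a g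
dilateS-⊛ a f g N = trans (cong (powℚ a N *_) (⊛-coeff f g N))
  (trans (*-distribˡ-Σ< (suc N) (powℚ a N) _)
  (trans (Σ<-cong-< (suc N) (λ i i≤N → term i (ℕP.≤-pred i≤N))) (sym (⊛-coeff (dilateS a f) (dilateS a g) N))))
  where
  term : ∀ i → i ≤ N → powℚ a N * (f i * g (N ∸ i)) ≡ powℚ a i * f i * (powℚ a (N ∸ i) * g (N ∸ i))
  term i i≤N = trans (cong (λ k → powℚ a k * (f i * g (N ∸ i))) (sym (ℕP.m+[n∸m]≡n i≤N)))
    (trans (cong (_* (f i * g (N ∸ i))) (powℚ-+ a i (N ∸ i)))
      (solve 4 (λ p q x y → p :* q :* (x :* y) := p :* x :* (q :* y)) refl (powℚ a i) (powℚ a (N ∸ i)) (f i) (g (N ∸ i))))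

dilateS-const : ∀ a c → dilateS a (constS c) ≈ₛ constS c
dilateS-const a c zero    = *-identityˡ c
dilateS-const a c (suc N) = *-zeroʳ (powℚ a (suc N))

powS-cong : ∀ {f g} → f ≈ₛ g → ∀ j → powS f j ≈ₛ powS g j
powS-cong f≈g zero    N = refl
powS-cong f≈g (suc j)   = ⊛-cong f≈g (powS-cong f≈g j)

powS-dilateS : ∀ a f j → powS (dilateS a f) j ≈ₛ dilateS a (powS f j)
powS-dilateS a f zero    N = sym (dilateS-const a 1ℚ N)
powS-dilateS a f (suc j) N =
  trans (⊛-congˡ (dilateS a f) (powS-dilateS a f j) N) (sym (dilateS-⊛ a f (powS f j) N))

powS-scaleS : ∀ c f j → powS (scaleS c f) j ≈ₛ scaleS (powℚ c j) (powS f j)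
powS-scaleS c f zero    N = sym (*-identityˡ _)
powS-scaleS c f (suc j) N =
  trans (⊛-congˡ (scaleS c f) (powS-scaleS c f j) N) (scaleS-⊛-scaleS c (powℚ c j) f (powS f j) N)

-- The generating function

eᵗ : Series
eᵗ = expS 1ℚ

eᵗ-1 : Series
eᵗ-1 = eᵗ ⊖ oneS

eᵗ+1 : Series
eᵗ+1 = eᵗ ⊕ oneS

eᵗ-coeff : ∀ N → eᵗ N ≡ invFact N
eᵗ-coeff N = trans (cong (_* invFact N) (powℚ-1ℚ N)) (*-identityˡ _)

Σ<-binomial : ∀ N → Σ< (suc N) (λ i → ℕ→ℚ (N C i)) ≡ powℚ 2ℚ N
Σ<-binomial zero    = Σ<-one _
Σ<-binomial (suc N) = begin
  Σ< (suc (suc N)) (λ i → ℕ→ℚ (suc N C i))          ≡⟨ Σ<-suc (suc N) _ ⟩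
  1ℚ + Σ< (suc N) (λ i → ℕ→ℚ (suc N C suc i))       ≡⟨ cong (_+_ 1ℚ) (Σ<-cong (suc N) pascal) ⟩
  1ℚ + Σ< (suc N) (λ i → ℕ→ℚ (N C i) + ℕ→ℚ (N C suc i))
    ≡⟨ cong (_+_ 1ℚ) (trans (Σ<-+ (suc N) _ _) (cong (_+ A) (Σ<-binomial N))) ⟩
  1ℚ + (P + A)                                       ≡⟨ solve 3 (λ o p a → o :+ (p :+ a) := p :+ (o :+ a)) refl 1ℚ P A ⟩
  P + (1ℚ + A)                                       ≡⟨ cong (_+_ P) (sym (Σ<-suc (suc N) _)) ⟩
  P + Σ< (suc (suc N)) (λ i → ℕ→ℚ (N C i))          ≡⟨ cong (_+_ P) (Σ<-last (suc N) _) ⟩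
  P + (Σ< (suc N) (λ i → ℕ→ℚ (N C i)) + ℕ→ℚ (N C suc N))
    ≡⟨ cong₂ (λ x y → P + (x + ℕ→ℚ y)) (Σ<-binomial N) (k>n⇒nCk≡0 (ℕP.n<1+n N)) ⟩
  P + (P + 0ℚ)                                       ≡⟨ solve 1 (λ p → p :+ (p :+ con 0ℚ) := con 2ℚ :* p) refl P ⟩
  2ℚ * P                                             ∎
  where
  open ≡-Reasoning
  A = Σ< (suc N) (λ i → ℕ→ℚ (N C suc i))
  P = powℚ 2ℚ N
  pascal : ∀ i → ℕ→ℚ (suc N C suc i) ≡ ℕ→ℚ (N C i) + ℕ→ℚ (N C suc i)
  pascal i = trans (cong ℕ→ℚ (sym (nCk+nC[k+1]≡[n+1]C[k+1] N i))) (ℕ→ℚ-+ (N C i) (N C suc i))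

eᵗ⊛eᵗ≈e²ᵗ : eᵗ ⊛ eᵗ ≈ₛ expS 2ℚ
eᵗ⊛eᵗ≈e²ᵗ N = begin
  (eᵗ ⊛ eᵗ) N                                        ≡⟨ ⊛-coeff eᵗ eᵗ N ⟩
  Σ< (suc N) (λ i → eᵗ i * eᵗ (N ∸ i))                ≡⟨ Σ<-cong-< (suc N) (λ i i≤N → term i (ℕP.≤-pred i≤N)) ⟩
  Σ< (suc N) (λ i → ℕ→ℚ (N C i) * invFact N)         ≡⟨ sym (*-distribʳ-Σ< (suc N) (invFact N) _) ⟩
  Σ< (suc N) (λ i → ℕ→ℚ (N C i)) * invFact N         ≡⟨ cong (_* invFact N) (Σ<-binomial N) ⟩
  expS 2ℚ N                                          ∎
  where
  open ≡-Reasoning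
  term : ∀ i → i ≤ N → eᵗ i * eᵗ (N ∸ i) ≡ ℕ→ℚ (N C i) * invFact N
  term i i≤N = begin
    eᵗ i * eᵗ (N ∸ i)                     ≡⟨ cong₂ _*_ (eᵗ-coeff i) (eᵗ-coeff (N ∸ i)) ⟩
    x * y                                 ≡⟨ solve 2 (λ x y → x :* y := x :* y :* con 1ℚ) refl x y ⟩
    x * y * 1ℚ                            ≡⟨ cong (x * y *_) (sym (n!*[1/n!]≡1 N)) ⟩
    x * y * (ℕ→ℚ (fact N) * z)            ≡⟨ cong (λ w → x * y * (w * z)) (sym (nCk*k!*[n∸k]!≡n! i≤N)) ⟩
    x * y * (Cn * (Fi * Fj) * z)          ≡⟨ solve 6 (λ x y z c a b → x :* y :* (c :* (a :* b) :* z) := c :* z :* (a :* x) :* (b :* y))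
                                               refl x y z Cn Fi Fj ⟩
    Cn * z * (Fi * x) * (Fj * y)          ≡⟨ cong₂ (λ u v → Cn * z * u * v) (n!*[1/n!]≡1 i) (n!*[1/n!]≡1 (N ∸ i)) ⟩
    Cn * z * 1ℚ * 1ℚ                      ≡⟨ solve 2 (λ c z → c :* z :* con 1ℚ :* con 1ℚ := c :* z) refl Cn z ⟩
    Cn * z                                ∎
    where
    x = invFact i
    y = invFact (N ∸ i)
    z = invFact N
    Cn = ℕ→ℚ (N C i)
    Fi = ℕ→ℚ (fact i)
    Fj = ℕ→ℚ (fact (N ∸ i))

[eᵗ-1]⊛[eᵗ+1]≈e²ᵗ-1 : eᵗ-1 ⊛ eᵗ+1 ≈ₛ expS 2ℚ ⊖ oneS
[eᵗ-1]⊛[eᵗ+1]≈e²ᵗ-1 N = begin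
  (eᵗ-1 ⊛ eᵗ+1) N                                   ≡⟨ ⊛-distribʳ-⊖ eᵗ oneS eᵗ+1 N ⟩
  (eᵗ ⊛ eᵗ+1) N - (oneS ⊛ eᵗ+1) N                   ≡⟨ cong₂ _-_ (⊛-comm eᵗ eᵗ+1 N) (⊛-identityˡ eᵗ+1 N) ⟩
  (eᵗ+1 ⊛ eᵗ) N - eᵗ+1 N                            ≡⟨ cong (_- eᵗ+1 N) (⊛-distribʳ-⊕ eᵗ oneS eᵗ N) ⟩
  ((eᵗ ⊛ eᵗ) N + (oneS ⊛ eᵗ) N) - eᵗ+1 N            ≡⟨ cong₂ (λ x y → (x + y) - eᵗ+1 N) (eᵗ⊛eᵗ≈e²ᵗ N) (⊛-identityˡ eᵗ N) ⟩
  (expS 2ℚ N + eᵗ N) - (eᵗ N + oneS N)              ≡⟨ solve 3 (λ e x o → (e :+ x) :- (x :+ o) := e :- o) refl (expS 2ℚ N) (eᵗ N) (oneS N) ⟩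
  expS 2ℚ N - oneS N                                ∎
  where open ≡-Reasoning

t/[e²ᵗ-1] : Series
t/[e²ᵗ-1] = scaleS ½ (dilateS 2ℚ BernoulliSeries)

[e²ᵗ-1]/t-dilate : divT (expS 2ℚ ⊖ oneS) ≈ₛ scaleS 2ℚ (dilateS 2ℚ (divT eᵗ-1))
[e²ᵗ-1]/t-dilate N = begin
  expS 2ℚ (suc N) - 0ℚ
    ≡⟨ solve 2 (λ p x → con 2ℚ :* p :* x :- con 0ℚ := con 2ℚ :* (p :* (con 1ℚ :* x :- con 0ℚ))) refl (powℚ 2ℚ N) (invFact (suc N)) ⟩
  2ℚ * (powℚ 2ℚ N * (1ℚ * invFact (suc N) - 0ℚ))
    ≡⟨ cong (λ u → 2ℚ * (powℚ 2ℚ N * (u * invFact (suc N) - 0ℚ))) (sym (powℚ-1ℚ (suc N))) ⟩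
  scaleS 2ℚ (dilateS 2ℚ (divT eᵗ-1)) N ∎
  where open ≡-Reasoning

[eᵗ-1]/t⊛bernoulli≈1 : divT eᵗ-1 ⊛ BernoulliSeries ≈ₛ oneS
[eᵗ-1]/t⊛bernoulli≈1 N = trans (⊛-comm (divT eᵗ-1) BernoulliSeries N) (invS-inverseˡ (divT eᵗ-1) N)

1/[eᵗ+1]≈[eᵗ-1]/t⊛t/[e²ᵗ-1] : invS eᵗ+1 ≈ₛ divT eᵗ-1 ⊛ t/[e²ᵗ-1]
1/[eᵗ+1]≈[eᵗ-1]/t⊛t/[e²ᵗ-1] = invS-unique eᵗ+1 (divT eᵗ-1 ⊛ t/[e²ᵗ-1]) λ N → begin
  (eᵗ+1 ⊛ (divT eᵗ-1 ⊛ t/[e²ᵗ-1])) N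
    ≡⟨ sym (⊛-assoc eᵗ+1 (divT eᵗ-1) t/[e²ᵗ-1] N) ⟩
  ((eᵗ+1 ⊛ divT eᵗ-1) ⊛ t/[e²ᵗ-1]) N
    ≡⟨ ⊛-congʳ t/[e²ᵗ-1] (λ M → begin
         (eᵗ+1 ⊛ divT eᵗ-1) M                         ≡⟨ ⊛-comm eᵗ+1 (divT eᵗ-1) M ⟩
         (divT eᵗ-1 ⊛ eᵗ+1) M                         ≡⟨ divT-⊛ eᵗ-1 eᵗ+1 refl M ⟩
         (eᵗ-1 ⊛ eᵗ+1) (suc M)                        ≡⟨ [eᵗ-1]⊛[eᵗ+1]≈e²ᵗ-1 (suc M) ⟩
         divT (expS 2ℚ ⊖ oneS) M                      ≡⟨ [e²ᵗ-1]/t-dilate M ⟩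
         scaleS 2ℚ (dilateS 2ℚ (divT eᵗ-1)) M         ∎) N ⟩
  (scaleS 2ℚ (dilateS 2ℚ (divT eᵗ-1)) ⊛ t/[e²ᵗ-1]) N
    ≡⟨ scaleS-⊛-scaleS 2ℚ ½ (dilateS 2ℚ (divT eᵗ-1)) (dilateS 2ℚ BernoulliSeries) N ⟩
  (2ℚ * ½) * (dilateS 2ℚ (divT eᵗ-1) ⊛ dilateS 2ℚ BernoulliSeries) N
    ≡⟨ trans (*-identityˡ _) (sym (dilateS-⊛ 2ℚ (divT eᵗ-1) BernoulliSeries N)) ⟩
  powℚ 2ℚ N * (divT eᵗ-1 ⊛ BernoulliSeries) N
    ≡⟨ cong (powℚ 2ℚ N *_) ([eᵗ-1]/t⊛bernoulli≈1 N) ⟩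
  powℚ 2ℚ N * oneS N
    ≡⟨ dilateS-const 2ℚ 1ℚ N ⟩
  oneS N ∎
  where open ≡-Reasoning

-- Reading off coefficients

1-e⁻²ᵗ : Series
1-e⁻²ᵗ = oneS ⊖ expS (- 2ℚ)

1-e⁻²ᵗ≈-[e⁻²ᵗ-1] : 1-e⁻²ᵗ ≈ₛ scaleS (- 1ℚ) (dilateS (- 2ℚ) eᵗ-1)
1-e⁻²ᵗ≈-[e⁻²ᵗ-1] N = begin
  oneS N - p * invFact N
    ≡⟨ cong (_- p * invFact N) (sym (dilateS-const (- 2ℚ) 1ℚ N)) ⟩
  p * oneS N - p * invFact N
    ≡⟨ solve 3 (λ p o x → p :* o :- p :* x := :- con 1ℚ :* (p :* (con 1ℚ :* x :- o))) refl p (oneS N) (invFact N) ⟩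
  - 1ℚ * (p * (1ℚ * invFact N - oneS N))
    ≡⟨ cong (λ z → - 1ℚ * (p * (z * invFact N - oneS N))) (sym (powℚ-1ℚ N)) ⟩
  scaleS (- 1ℚ) (dilateS (- 2ℚ) eᵗ-1) N ∎
  where
  open ≡-Reasoning
  p = powℚ (- 2ℚ) N

powS-1-e⁻²ᵗ : ∀ j N → powS 1-e⁻²ᵗ j N ≡ powℚ (- 1ℚ) j * (powℚ (- 2ℚ) N * powS eᵗ-1 j N)
powS-1-e⁻²ᵗ j N = begin
  powS 1-e⁻²ᵗ j N                                              ≡⟨ powS-cong 1-e⁻²ᵗ≈-[e⁻²ᵗ-1] j N ⟩
  powS (scaleS (- 1ℚ) (dilateS (- 2ℚ) eᵗ-1)) j N               ≡⟨ powS-scaleS (- 1ℚ) (dilateS (- 2ℚ) eᵗ-1) j N ⟩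
  powℚ (- 1ℚ) j * powS (dilateS (- 2ℚ) eᵗ-1) j N               ≡⟨ cong (powℚ (- 1ℚ) j *_) (powS-dilateS (- 2ℚ) eᵗ-1 j N) ⟩
  powℚ (- 1ℚ) j * (powℚ (- 2ℚ) N * powS eᵗ-1 j N)              ∎
  where open ≡-Reasoning

powS-eᵗ-1-coeff : ∀ j N → powS eᵗ-1 j N ≡ S₂ N j * ℕ→ℚ (fact j) * invFact N
powS-eᵗ-1-coeff j N = sym (begin
  ℕ→ℚ (fact N) * P * invFact j * ℕ→ℚ (fact j) * invFact N
    ≡⟨ solve 5 (λ fN p ij fj iN → fN :* p :* ij :* fj :* iN := (fN :* iN) :* (fj :* ij) :* p) refl
         (ℕ→ℚ (fact N)) P (invFact j) (ℕ→ℚ (fact j)) (invFact N) ⟩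
  (ℕ→ℚ (fact N) * invFact N) * (ℕ→ℚ (fact j) * invFact j) * P
    ≡⟨ cong₂ (λ x y → x * y * P) (n!*[1/n!]≡1 N) (n!*[1/n!]≡1 j) ⟩
  1ℚ * 1ℚ * P
    ≡⟨ solve 1 (λ p → con 1ℚ :* con 1ℚ :* p := p) refl P ⟩
  P ∎)
  where
  open ≡-Reasoning
  P = powS eᵗ-1 j N

[eᵗ-1]/t-coeff : ∀ a → divT eᵗ-1 a ≡ invFact (suc a)
[eᵗ-1]/t-coeff a = trans (cong (_- 0ℚ) (eᵗ-coeff (suc a))) (+-identityʳ _)

t/[e²ᵗ-1]-coeff : ∀ b → t/[e²ᵗ-1] b ≡ ½ * powℚ 2ℚ b * B b * invFact b
t/[e²ᵗ-1]-coeff b = sym (begin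
  ½ * powℚ 2ℚ b * (ℕ→ℚ (fact b) * β) * invFact b
    ≡⟨ solve 5 (λ h p f β i → h :* p :* (f :* β) :* i := h :* (p :* β) :* (f :* i)) refl ½ (powℚ 2ℚ b) (ℕ→ℚ (fact b)) β (invFact b) ⟩
  ½ * (powℚ 2ℚ b * β) * (ℕ→ℚ (fact b) * invFact b)
    ≡⟨ trans (cong (½ * (powℚ 2ℚ b * β) *_) (n!*[1/n!]≡1 b)) (*-identityʳ _) ⟩
  ½ * (powℚ 2ℚ b * β) ∎)
  where
  open ≡-Reasoning
  β = BernoulliSeries b

[Li/t]-coeff : ∀ k m → divT (LiS k 1-e⁻²ᵗ) m ≡ Σ< (suc m) (λ i → natZPow (suc i) (ℤ.- k) * powS 1-e⁻²ᵗ (suc i) (suc m))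
[Li/t]-coeff k m = Σ1to≡Σ< (suc m) (λ n → natZPow n (ℤ.- k) * powS 1-e⁻²ᵗ n (suc m))

summand : ℤ → ℕ → ℕ → ℕ → ℕ → ℚ
summand k n l m j =
  ℕ→ℚ (n C l) * ℕ→ℚ (l C m)
    * ℕ→ℚ (2 ℕ.^ (m ℕ.+ n ∸ l)) * powℚ (- 1ℚ) (suc m ℕ.+ j) * ℕ→ℚ (fact j)
    * (+ 1 / (suc (l ∸ m) ℕ.* suc m)) * natZPow j (ℤ.- k)
    * S₂ (suc m) j * B (n ∸ l)

collect-signs-and-powers : ∀ j m b → powℚ (- 1ℚ) j * powℚ (- 2ℚ) (suc m) * ½ * powℚ 2ℚ b
                  ≡ powℚ (- 1ℚ) (suc m ℕ.+ j) * ℕ→ℚ (2 ℕ.^ (m ℕ.+ b))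
collect-signs-and-powers j m b = begin
  u j * powℚ (- 1ℚ * 2ℚ) (suc m) * ½ * t b
    ≡⟨ cong (λ z → u j * z * ½ * t b) (powℚ-* (- 1ℚ) 2ℚ (suc m)) ⟩
  u j * (u (suc m) * (2ℚ * t m)) * ½ * t b
    ≡⟨ solve 4 (λ uj usm tm tb → uj :* (usm :* (con 2ℚ :* tm)) :* con ½ :* tb := usm :* uj :* (tm :* tb)) refl
         (u j) (u (suc m)) (t m) (t b) ⟩
  u (suc m) * u j * (t m * t b)
    ≡⟨ sym (cong₂ _*_ (powℚ-+ (- 1ℚ) (suc m) j) (trans (ℕ→ℚ-^ 2 (m ℕ.+ b)) (powℚ-+ 2ℚ m b))) ⟩
  u (suc m ℕ.+ j) * ℕ→ℚ (2 ℕ.^ (m ℕ.+ b)) ∎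
  where
  open ≡-Reasoning
  u = powℚ (- 1ℚ)
  t = powℚ 2ℚ

summand-from-coefficients : ∀ k {n l m} j → l ≤ n → m ≤ l →
  ℕ→ℚ (fact n) * (natZPow j (ℤ.- k) * powS 1-e⁻²ᵗ j (suc m) * divT eᵗ-1 (l ∸ m) * t/[e²ᵗ-1] (n ∸ l))
    ≡ summand k n l m j
summand-from-coefficients k {n} {l} {m} j l≤n m≤l = begin
  ℕ→ℚ (fact n) * (w * powS 1-e⁻²ᵗ j (suc m) * divT eᵗ-1 a * t/[e²ᵗ-1] b)
    ≡⟨ cong₂ (λ x y → ℕ→ℚ (fact n) * (w * x * y * t/[e²ᵗ-1] b)) (powS-1-e⁻²ᵗ j (suc m)) ([eᵗ-1]/t-coeff a) ⟩
  ℕ→ℚ (fact n) * (w * (u j * (powℚ (- 2ℚ) (suc m) * powS eᵗ-1 j (suc m))) * invFact (suc a) * t/[e²ᵗ-1] b)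
    ≡⟨ cong₂ (λ x y → ℕ→ℚ (fact n) * (w * (u j * (powℚ (- 2ℚ) (suc m) * x)) * invFact (suc a) * y))
             (powS-eᵗ-1-coeff j (suc m)) (t/[e²ᵗ-1]-coeff b) ⟩
  ℕ→ℚ (fact n) * (w * (u j * (powℚ (- 2ℚ) (suc m) * (s * ℕ→ℚ (fact j) * invFact (suc m)))) * invFact (suc a)
                    * (½ * powℚ 2ℚ b * B b * invFact b))
    ≡⟨ solve 12 (λ fn w uj p2 s fj ism isa h tb Bb ib →
         fn :* (w :* (uj :* (p2 :* (s :* fj :* ism))) :* isa :* (h :* tb :* Bb :* ib))
           := (fn :* ism :* isa :* ib) :* (uj :* p2 :* h :* tb) :* (fj :* w :* s :* Bb)) refl
         (ℕ→ℚ (fact n)) w (u j) (powℚ (- 2ℚ) (suc m)) s (ℕ→ℚ (fact j)) (invFact (suc m)) (invFact (suc a))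
         ½ (powℚ 2ℚ b) (B b) (invFact b) ⟩
  (ℕ→ℚ (fact n) * invFact (suc m) * invFact (suc a) * invFact b)
    * (u j * powℚ (- 2ℚ) (suc m) * ½ * powℚ 2ℚ b) * (ℕ→ℚ (fact j) * w * s * B b)
    ≡⟨ cong₂ (λ x y → x * y * (ℕ→ℚ (fact j) * w * s * B b)) (multinomial l≤n m≤l) (collect-signs-and-powers j m b) ⟩
  (Cnl * Clm * r) * (u (suc m ℕ.+ j) * ℕ→ℚ (2 ℕ.^ (m ℕ.+ b))) * (ℕ→ℚ (fact j) * w * s * B b)
    ≡⟨ solve 9 (λ cnl clm r usj p fj w s Bb →
         (cnl :* clm :* r) :* (usj :* p) :* (fj :* w :* s :* Bb) := cnl :* clm :* p :* usj :* fj :* r :* w :* s :* Bb) refl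
         Cnl Clm r (u (suc m ℕ.+ j)) (ℕ→ℚ (2 ℕ.^ (m ℕ.+ b))) (ℕ→ℚ (fact j)) w s (B b) ⟩
  Cnl * Clm * ℕ→ℚ (2 ℕ.^ (m ℕ.+ b)) * u (suc m ℕ.+ j) * ℕ→ℚ (fact j) * r * w * s * B b
    ≡⟨ cong (λ e → Cnl * Clm * ℕ→ℚ (2 ℕ.^ e) * u (suc m ℕ.+ j) * ℕ→ℚ (fact j) * r * w * s * B b)
            (sym (ℕP.+-∸-assoc m l≤n)) ⟩
  summand k n l m j ∎
  where
  open ≡-Reasoning
  a = l ∸ m
  b = n ∸ l
  w = natZPow j (ℤ.- k)
  u = powℚ (- 1ℚ)
  s = S₂ (suc m) j
  Cnl = ℕ→ℚ (n C l)
  Clm = ℕ→ℚ (l C m)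
  r = + 1 / (suc a ℕ.* suc m)

Σ0to³≡Σ<³ : ∀ n (t : ℕ → ℕ → ℕ → ℚ) →
  Σ0to n (λ l → Σ0to l (λ m → Σ1to (suc m) (t l m)))
    ≡ Σ< (suc n) (λ l → Σ< (suc l) (λ m → Σ< (suc m) (λ i → t l m (suc i))))
Σ0to³≡Σ<³ n t = trans (Σ0to≡Σ< n _) (Σ<-cong (suc n) (λ l →
  trans (Σ0to≡Σ< l _) (Σ<-cong (suc l) (λ m → Σ1to≡Σ< (suc m) (t l m)))))

mainTheorem3 : (n : ℕ) (k : ℤ) →
    polyEuler n k ≡
      Σ0to n (λ l → Σ0to l (λ m → Σ1to (suc m) (λ j →
        ℕ→ℚ (n C l) * ℕ→ℚ (l C m)
          * ℕ→ℚ (2 ℕ.^ (m ℕ.+ n ∸ l)) * powℚ (- 1ℚ) (suc m ℕ.+ j) * ℕ→ℚ (fact j)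
          * (+ 1 / (suc (l ∸ m) ℕ.* suc m)) * natZPow j (ℤ.- k)
          * S₂ (suc m) j * B (n ∸ l))))
mainTheorem3 n k = begin
  n! * (Li/t ⊛ invS eᵗ+1) n
    ≡⟨ cong (n! *_) (⊛-congˡ Li/t 1/[eᵗ+1]≈[eᵗ-1]/t⊛t/[e²ᵗ-1] n) ⟩
  n! * (Li/t ⊛ (divT eᵗ-1 ⊛ t/[e²ᵗ-1])) n
    ≡⟨ cong (n! *_) (sym (⊛-assoc Li/t (divT eᵗ-1) t/[e²ᵗ-1] n)) ⟩
  n! * ((Li/t ⊛ divT eᵗ-1) ⊛ t/[e²ᵗ-1]) n
    ≡⟨ *-[⊛-⊛]-coeff n! _ Li/t (divT eᵗ-1) t/[e²ᵗ-1] n ([Li/t]-coeff k) ⟩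
  Σ< (suc n) (λ l → Σ< (suc l) (λ m → Σ< (suc m) (λ i →
    n! * (natZPow (suc i) (ℤ.- k) * powS 1-e⁻²ᵗ (suc i) (suc m) * divT eᵗ-1 (l ∸ m) * t/[e²ᵗ-1] (n ∸ l)))))
    ≡⟨ Σ<-cong-< (suc n) (λ l l<1+n → Σ<-cong-< (suc l) (λ m m<1+l → Σ<-cong (suc m) (λ i →
         summand-from-coefficients k (suc i) (ℕP.≤-pred l<1+n) (ℕP.≤-pred m<1+l)))) ⟩
  Σ< (suc n) (λ l → Σ< (suc l) (λ m → Σ< (suc m) (λ i → summand k n l m (suc i))))
    ≡⟨ sym (Σ0to³≡Σ<³ n (summand k n)) ⟩
  Σ0to n (λ l → Σ0to l (λ m → Σ1to (suc m) (summand k n l m))) ∎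
  where
  open ≡-Reasoning
  n! = ℕ→ℚ (fact n)
  Li/t = divT (LiS k 1-e⁻²ᵗ)
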